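{- Let $G$ be a graph (no loops), $k\ge 1$ an integer, $0<\epsilon\le\frac12$, and let $I'$ be the $\textsc{MinSumC}$ instance constructed from $(G,k)$ and $\epsilon$ as in the context, with $k'=N+k\,f$ where $N=|E(G)|$ and $f=f(N,\epsilon)$. If $G$ has a vertex cover $T$ with $|T|\le k$, then $I'$ admits an $\mathcal{A}$-perfect envy-free matching $M$ with $c(M)\le k'$.
   Context: $\textsc{MinSumC}$ instance: agents $\mathcal{A}$, programs $\mathcal{P}$, acceptable pairs $E$, strict preference orders of each agent over its acceptable programs and of each program over its acceptable agents, and a non-negative integer cost $c(p)$ per program (no capacity limits). A matching $M\subseteq E$ has each agent in at most one pair; $M(a)$ is $a$'s partner or $\bot$, with every acceptable program preferred to $\bot$. $M$ is envy-free if there are no $(a,p)\in M$ and agent $a'$ acceptable to $p$ with $a'\succ_p a$ and $p\succ_{a'}M(a')$; $\mathcal{A}$-perfect if all agents are matched; $c(M)=\sum_{(a,p)\in M}c(p)$. A vertex cover of $G$ is a set $T$ of vertices such that every edge has an endpoint in $T$. Construction: form the set cover instance with universe $\mathcal{U}=E(G)=\{e_1,\dots,e_N\}$ and, for each vertex $v_j$, the set $C_j$ of edges incident on $v_j$. Let $f(N,\epsilon)=\left\lceil\frac{2N(1-\epsilon)}{\epsilon}\right\rceil$. $I'$ has: for each element $e_i$ an element-agent $a_i$; for each set $C_j$ a subset-program $c_j$ of cost $1$, and $f$ dummy agents $u_j^1,\dots,u_j^f$ and $f$ dummy programs $w_j^1,\dots,w_j^f$ of cost $0$. Preferences: $a_i$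 ranks exactly $\{c_j: e_i\in C_j\}$ in a fixed arbitrary order; $u_j^l: c_j\succ w_j^l$; $c_j$ ranks all $u_j^l$ (fixed order) above all $a_i$ with $e_i\in C_j$ (fixed order); $w_j^l$ ranks only $u_j^l$.
   Formalization: The parameter ε ranges over the rationals in the interval (0, ½]. -}

module Defs where

open import Data.Nat using (ℕ; zero; suc)
open import Data.Fin using (Fin)
open import Data.Fin.Properties using (_≟_)
open import Data.List using (List; []; _∷_; _++_; map; allFin; concatMap; filter)
open import Data.Nat.ListAction using (sum)
open import Data.List.Membership.Propositional using (_∈_)
open import Data.Maybe using (Maybe; just; nothing; maybe)
open import Data.Product using (Σ; ∃; ∃-syntax; _×_; _,_; proj₁; proj₂)
open import Data.Sum using (_⊎_)
open import Relation.Nullary using (¬_)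
open import Relation.Nullary.Decidable using (_⊎-dec_)
open import Relation.Binary.PropositionalEquality using (_≡_; _≢_)
open import Data.Integer using (ℤ; +_)
import Data.Integer as ℤ
open import Data.Rational using (ℚ; 1ℚ; _-_; _*_; _÷_; ceiling; Positive)
open import Data.Rational.Properties using (pos⇒nonZero)

-- Strict preference from a rank list (most preferred first):
-- x is strictly preferred to y in xs iff x occurs in xs and y occurs
-- strictly after that occurrence.

Prefers : {A : Set} → List A → A → A → Set
Prefers {A} xs x y = Σ (List A) λ ys → Σ (List A) λ zs → (xs ≡ ys ++ x ∷ zs) × (y ∈ zs)

-- A MinSumC instance (no capacities).

record Instance : Set₁ where
  field
    Agent   : Set
    Program : Set
    agents  : List Agent               -- enumeration of all agents (each once)
    prefA   : Agent → List Program     -- agent's acceptable programs, best first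
    prefP   : Program → List Agent     -- program's acceptable agents, best first
    cost    : Program → ℕ

module _ (I : Instance) where
  open Instance I

  Acceptable : Agent → Program → Set
  Acceptable a p = (p ∈ prefA a) × (a ∈ prefP p)

  -- Matching: each agent in at most one pair (a function to Maybe),
  -- all pairs acceptable.
  record Matching : Set where
    field
      M     : Agent → Maybe Program
      valid : ∀ a p → M a ≡ just p → Acceptable a p
  open Matching public

  -- p ≻_a q, where q may be ⊥ (nothing); every acceptable program beats ⊥.
  AgentPrefers : Agent → Program → Maybe Program → Set
  AgentPrefers a p nothing  = p ∈ prefA a
  AgentPrefers a p (just q) = Prefers (prefA a) p q

  EnvyFree : Matching → Set
  EnvyFree μ = ∀ a p a' → M μ a ≡ just p → a' ∈ prefP p →
    Prefers (prefP p) a' a → ¬ AgentPrefers a' p (M μ a')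

  APerfect : Matching → Set
  APerfect μ = ∀ a → ∃[ p ] (M μ a ≡ just p)

  matchCost : Matching → ℕ
  matchCost μ = sum (map (λ a → maybe cost 0 (M μ a)) agents)

record Graph : Set where
  field
    n    : ℕ
    N    : ℕ
    edge : Fin N → Fin n × Fin n

module _ (G : Graph) where
  open Graph G

  Loopless : Set
  Loopless = ∀ i → proj₁ (edge i) ≢ proj₂ (edge i)

  -- vertex cover given as a list of vertices (size = its length)
  IsVertexCover : List (Fin n) → Set
  IsVertexCover T = ∀ i → (proj₁ (edge i) ∈ T) ⊎ (proj₂ (edge i) ∈ T)

  -- indices of edges incident on v_j, in increasing order (e_i ∈ C_j)
  incident : Fin n → List (Fin N)
  incident j = filter (λ i → (proj₁ (edge i) ≟ j) ⊎-dec (proj₂ (edge i) ≟ j)) (allFin N)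

-- f(N, ε) = ⌈ 2N(1-ε)/ε ⌉  (as a natural; it is ≥ 0 for 0 < ε ≤ 1)

fNε : ℕ → (ε : ℚ) → .{{Positive ε}} → ℕ
fNε N ε = ℤ.∣ ceiling (((+ (2 Data.Nat.* N)) Data.Rational./ 1 * (1ℚ - ε)) ÷ ε) ∣
  where instance _ = pos⇒nonZero ε

data Ag (n N f : ℕ) : Set where
  elemA : Fin N → Ag n N f              -- a_i
  dumA  : Fin n → Fin f → Ag n N f      -- u_j^l

data Pr (n f : ℕ) : Set where
  subP : Fin n → Pr n f                 -- c_j
  dumP : Fin n → Fin f → Pr n f         -- w_j^l

-- uOrd j : the fixed order in which c_j ranks u_j^1..u_j^f
-- aOrd j : the fixed order in which c_j ranks the a_i with e_i ∈ C_j
-- (the order in which a_i ranks its two programs is the order of the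
--  endpoints in edge i)
constructed : (G : Graph) (f : ℕ) →
  (uOrd : Fin (Graph.n G) → List (Fin f)) →
  (aOrd : Fin (Graph.n G) → List (Fin (Graph.N G))) → Instance
constructed G f uOrd aOrd = record
  { Agent   = Ag n N f
  ; Program = Pr n f
  ; agents  = map elemA (allFin N) ++ concatMap (λ j → map (dumA j) (allFin f)) (allFin n)
  ; prefA   = pA
  ; prefP   = pP
  ; cost    = c
  }
  where
  open Graph G
  pA : Ag n N f → List (Pr n f)
  pA (elemA i)  = subP (proj₁ (edge i)) ∷ subP (proj₂ (edge i)) ∷ []
  pA (dumA j l) = subP j ∷ dumP j l ∷ []
  pP : Pr n f → List (Ag n N f)
  pP (subP j)   = map (dumA j) (uOrd j) ++ map elemA (aOrd j)
  pP (dumP j l) = dumA j l ∷ []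
  c : Pr n f → ℕ
  c (subP _)   = 1
  c (dumP _ _) = 0

-- Match each element-agent a_i to c_j for an endpoint v_j of e_i lying in T,
-- and each dummy u_j^l to c_j if v_j ∈ T and to w_j^l otherwise. Then every
-- agent is matched, and only programs c_j with v_j ∈ T receive agents. An agent
-- can only envy its first choice while holding its second, and that first
-- choice is always some c_j with v_j ∉ T (G is loopless, so the two choices of
-- a_i differ); nobody is matched there, so nobody is envied. The cost is one
-- per element-agent plus f per covered vertex, at most N + |T| f. Neither ε nor
-- the value of f plays any role.
module Submission where

open import Defs
open import Data.Bool using (true; false; if_then_else_)
open import Data.Fin using (Fin; zero; suc)
open import Data.Fin.Properties using (injective⇒≤) renaming (_≟_ to _≟ᶠ_)
open import Data.List using (List; []; _∷_; _++_; length; map; concatMap; filter; lookup; allFin)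
open import Data.List.Properties using (map-++; map-∘; map-cong; length-tabulate)
open import Data.List.Membership.Propositional using (_∈_; _∉_)
open import Data.List.Membership.Propositional.Properties
  using (∈-lookup; ∈-filter⁺; ∈-filter⁻; ∈-allFin; ∈-map⁺; ∈-++⁺ˡ; ∈-++⁺ʳ)
import Data.List.Membership.DecPropositional as DecMembership
open import Data.List.Relation.Binary.Permutation.Propositional using (_↭_; ↭-sym)
open import Data.List.Relation.Binary.Permutation.Propositional.Properties using (∈-resp-↭)
open import Data.List.Relation.Binary.Subset.Propositional using (_⊆_)
import Data.List.Relation.Unary.All as All
open import Data.List.Relation.Unary.AllPairs using (_∷_)
open import Data.List.Relation.Unary.Any using (here; there; index)
open import Data.List.Relation.Unary.Any.Properties using (lookup-index)
open import Data.List.Relation.Unary.Unique.Propositional using (Unique)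
open import Data.List.Relation.Unary.Unique.Propositional.Properties using (filter⁺; allFin⁺)
open import Data.Maybe using (just)
open import Data.Nat using (ℕ; _≤_; _+_; _*_)
open import Data.Nat.ListAction using (sum)
open import Data.Nat.ListAction.Properties using (sum-++)
open import Data.Nat.Properties using (*-identityʳ; *-zeroʳ; *-monoˡ-≤; +-monoʳ-≤; ≤-trans; ≤-reflexive)
open import Data.Product using (∃-syntax; _×_; _,_; proj₁; proj₂)
open import Data.Rational using (ℚ; Positive; ½)
import Data.Rational as ℚ
open import Data.Sum using (_⊎_; inj₁; inj₂)
open import Function using (_∘_)
open import Relation.Nullary using (yes; no; does; contradiction)
open import Relation.Nullary.Decidable using (_⊎-dec_)
open import Relation.Unary using (Decidable)
open import Relation.Binary.PropositionalEquality using (_≡_; refl; sym; trans; cong; cong₂; module ≡-Reasoning)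

Prefers-pair⁻ : {A : Set} {x y p q : A} → Prefers (x ∷ y ∷ []) p q → p ≡ x × q ≡ y
Prefers-pair⁻ ([] , _ , refl , here refl) = refl , refl
Prefers-pair⁻ (_ ∷ [] , _ , refl , ())
Prefers-pair⁻ (_ ∷ _ ∷ [] , _ , () , _)
Prefers-pair⁻ (_ ∷ _ ∷ _ ∷ _ , _ , () , _)

module _ {A : Set} where

  Unique-lookup-injective : {xs : List A} → Unique xs →
    ∀ i j → lookup xs i ≡ lookup xs j → i ≡ j
  Unique-lookup-injective (_ ∷ _) zero zero _ = refl
  Unique-lookup-injective (x≢xs ∷ _) zero (suc j) eq = contradiction eq (All.lookup x≢xs (∈-lookup j))
  Unique-lookup-injective (x≢xs ∷ _) (suc i) zero eq = contradiction (sym eq) (All.lookup x≢xs (∈-lookup i))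
  Unique-lookup-injective (_ ∷ u) (suc i) (suc j) eq = cong suc (Unique-lookup-injective u i j eq)

  Unique-⊆⇒length≤ : {xs ys : List A} → Unique xs → xs ⊆ ys → length xs ≤ length ys
  Unique-⊆⇒length≤ {xs} {ys} unique xs⊆ys = injective⇒≤ position-injective
    where
    position : Fin (length xs) → Fin (length ys)
    position i = index (xs⊆ys (∈-lookup i))

    position-injective : ∀ {i j} → position i ≡ position j → i ≡ j
    position-injective {i} {j} eq = Unique-lookup-injective unique i j (begin
      lookup xs i              ≡⟨ lookup-index (xs⊆ys (∈-lookup i)) ⟩
      lookup ys (position i)   ≡⟨ cong (lookup ys) eq ⟩
      lookup ys (position j)   ≡⟨ lookup-index (xs⊆ys (∈-lookup j)) ⟨
      lookup xs j              ∎)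
      where open ≡-Reasoning

  sum-map-const : ∀ c (xs : List A) → sum (map (λ _ → c) xs) ≡ length xs * c
  sum-map-const c []       = refl
  sum-map-const c (_ ∷ xs) = cong (c +_) (sum-map-const c xs)

  sum-map-if : ∀ {P : A → Set} (P? : Decidable P) c (xs : List A) →
    sum (map (λ x → if does (P? x) then c else 0) xs) ≡ length (filter P? xs) * c
  sum-map-if P? c [] = refl
  sum-map-if P? c (x ∷ xs) with does (P? x)
  ... | true  = cong (c +_) (sum-map-if P? c xs)
  ... | false = sum-map-if P? c xs

  sum-map-concatMap : {B : Set} (g : B → ℕ) (h : A → List B) (xs : List A) →
    sum (map g (concatMap h xs)) ≡ sum (map (λ x → sum (map g (h x))) xs)
  sum-map-concatMap g h [] = refl
  sum-map-concatMap g h (x ∷ xs) = begin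
    sum (map g (h x ++ concatMap h xs))
      ≡⟨ cong sum (map-++ g (h x) (concatMap h xs)) ⟩
    sum (map g (h x) ++ map g (concatMap h xs))
      ≡⟨ sum-++ (map g (h x)) _ ⟩
    sum (map g (h x)) + sum (map g (concatMap h xs))
      ≡⟨ cong (sum (map g (h x)) +_) (sum-map-concatMap g h xs) ⟩
    sum (map g (h x)) + sum (map (λ y → sum (map g (h y))) xs)
      ∎
    where open ≡-Reasoning

length-allFin : ∀ n → length (allFin n) ≡ n
length-allFin n = length-tabulate (λ i → i)

module CoverMatching
  (G : Graph) (loopless : Loopless G) (f : ℕ)
  (uOrd : Fin (Graph.n G) → List (Fin f)) (uOrd-complete : ∀ j → uOrd j ↭ allFin f)
  (aOrd : Fin (Graph.n G) → List (Fin (Graph.N G))) (aOrd-incident : ∀ j → aOrd j ↭ incident G j)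
  (T : List (Fin (Graph.n G))) (cover : IsVertexCover G T)
  where

  open Graph G
  open DecMembership (_≟ᶠ_ {n}) using (_∈?_)

  I' : Instance
  I' = constructed G f uOrd aOrd

  open Instance I' using (cost)

  e₁ e₂ : Fin N → Fin n
  e₁ i = proj₁ (edge i)
  e₂ i = proj₂ (edge i)

  coveringEndpoint : Fin N → Fin n
  coveringEndpoint i = if does (e₁ i ∈? T) then e₁ i else e₂ i

  coveringEndpoint∈T : ∀ i → coveringEndpoint i ∈ T
  coveringEndpoint∈T i with e₁ i ∈? T | cover i
  ... | yes e₁∈T | _        = e₁∈T
  ... | no  e₁∉T | inj₁ e₁∈T = contradiction e₁∈T e₁∉T
  ... | no  _    | inj₂ e₂∈T = e₂∈T

  partner : Ag n N f → Pr n f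
  partner (elemA i)  = subP (coveringEndpoint i)
  partner (dumA j l) = if does (j ∈? T) then subP j else dumP j l

  endpoint∈aOrd : ∀ {i j} → e₁ i ≡ j ⊎ e₂ i ≡ j → i ∈ aOrd j
  endpoint∈aOrd {i} {j} endpoint = ∈-resp-↭ (↭-sym (aOrd-incident j))
    (∈-filter⁺ (λ i → (e₁ i ≟ᶠ j) ⊎-dec (e₂ i ≟ᶠ j)) (∈-allFin i) endpoint)

  partner-acceptable : ∀ a → Acceptable I' a (partner a)
  partner-acceptable (elemA i) with e₁ i ∈? T
  ... | yes _ = here refl , ∈-++⁺ʳ _ (∈-map⁺ elemA (endpoint∈aOrd (inj₁ refl)))
  ... | no  _ = there (here refl) , ∈-++⁺ʳ _ (∈-map⁺ elemA (endpoint∈aOrd (inj₂ refl)))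
  partner-acceptable (dumA j l) with j ∈? T
  ... | yes _ = here refl , ∈-++⁺ˡ (∈-map⁺ (dumA j) (∈-resp-↭ (↭-sym (uOrd-complete j)) (∈-allFin l)))
  ... | no  _ = there (here refl) , here refl

  μ : Matching I'
  μ = record { M = λ a → just (partner a) ; valid = λ { a _ refl → partner-acceptable a } }

  μ-perfect : APerfect I' μ
  μ-perfect a = partner a , refl

  subP-injective : ∀ {j j′} → subP {n} {f} j ≡ subP j′ → j ≡ j′
  subP-injective refl = refl

  partner≡subP⇒∈T : ∀ a {j} → partner a ≡ subP j → j ∈ T
  partner≡subP⇒∈T (elemA i) refl = coveringEndpoint∈T i
  partner≡subP⇒∈T (dumA j l) eq with j ∈? T | eq
  ... | yes j∈T | refl = j∈T
  ... | no  _   | ()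

  envied⇒uncovered : ∀ a {p} → AgentPrefers I' a p (just (partner a)) → ∃[ j ] p ≡ subP j × j ∉ T
  envied⇒uncovered (elemA i) envy with e₁ i ∈? T | Prefers-pair⁻ envy
  ... | yes _    | _ , e₁≡e₂ = contradiction (subP-injective e₁≡e₂) (loopless i)
  ... | no  e₁∉T | refl , _  = e₁ i , refl , e₁∉T
  envied⇒uncovered (dumA j l) envy with j ∈? T | Prefers-pair⁻ envy
  ... | yes _  | _ , ()
  ... | no j∉T | refl , _ = j , refl , j∉T

  μ-envyFree : EnvyFree I' μ
  μ-envyFree a _ a' refl _ _ envy with envied⇒uncovered a' envy
  ... | j , partner≡subP , j∉T = j∉T (partner≡subP⇒∈T a partner≡subP)

  dummyCost : Fin n → ℕ
  dummyCost j = if does (j ∈? T) then f else 0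

  dummyAgents : Fin n → List (Ag n N f)
  dummyAgents j = map (dumA j) (allFin f)

  cost-dummyAgents : ∀ j → sum (map (cost ∘ partner) (dummyAgents j)) ≡ dummyCost j
  cost-dummyAgents j = begin
    sum (map (cost ∘ partner) (dummyAgents j))      ≡⟨ cong sum (map-∘ (allFin f)) ⟨
    sum (map (cost ∘ partner ∘ dumA j) (allFin f))  ≡⟨ cost-dummies ⟩
    dummyCost j                                     ∎
    where
    open ≡-Reasoning
    cost-dummies : sum (map (cost ∘ partner ∘ dumA j) (allFin f)) ≡ dummyCost j
    cost-dummies with does (j ∈? T)
    ... | true  = trans (sum-map-const 1 (allFin f)) (trans (*-identityʳ _) (length-allFin f))
    ... | false = trans (sum-map-const 0 (allFin f)) (*-zeroʳ (length (allFin f)))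

  coveredVertices : List (Fin n)
  coveredVertices = filter (_∈? T) (allFin n)

  coveredVertices≤T : length coveredVertices ≤ length T
  coveredVertices≤T = Unique-⊆⇒length≤ (filter⁺ (_∈? T) (allFin⁺ n))
    (proj₂ ∘ ∈-filter⁻ (_∈? T) {xs = allFin n})

  cost-elementAgents : sum (map (cost ∘ partner) (map elemA (allFin N))) ≡ N
  cost-elementAgents = begin
    sum (map (cost ∘ partner) (map elemA (allFin N)))  ≡⟨ cong sum (map-∘ (allFin N)) ⟨
    sum (map (λ _ → 1) (allFin N))                    ≡⟨ sum-map-const 1 (allFin N) ⟩
    length (allFin N) * 1                             ≡⟨ *-identityʳ _ ⟩
    length (allFin N)                                 ≡⟨ length-allFin N ⟩
    N                                                 ∎
    where open ≡-Reasoning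

  cost-allDummyAgents : sum (map (cost ∘ partner) (concatMap dummyAgents (allFin n))) ≡ length coveredVertices * f
  cost-allDummyAgents = begin
    sum (map (cost ∘ partner) (concatMap dummyAgents (allFin n)))
      ≡⟨ sum-map-concatMap (cost ∘ partner) dummyAgents (allFin n) ⟩
    sum (map (λ j → sum (map (cost ∘ partner) (dummyAgents j))) (allFin n))
      ≡⟨ cong sum (map-cong cost-dummyAgents (allFin n)) ⟩
    sum (map dummyCost (allFin n))
      ≡⟨ sum-map-if (_∈? T) f (allFin n) ⟩
    length coveredVertices * f
      ∎
    where open ≡-Reasoning

  matchCost-μ : matchCost I' μ ≡ N + length coveredVertices * f
  matchCost-μ = begin
    sum (map (cost ∘ partner) (elementAgents ++ allDummyAgents))
      ≡⟨ cong sum (map-++ (cost ∘ partner) elementAgents allDummyAgents) ⟩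
    sum (map (cost ∘ partner) elementAgents ++ map (cost ∘ partner) allDummyAgents)
      ≡⟨ sum-++ (map (cost ∘ partner) elementAgents) _ ⟩
    sum (map (cost ∘ partner) elementAgents) + sum (map (cost ∘ partner) allDummyAgents)
      ≡⟨ cong₂ _+_ cost-elementAgents cost-allDummyAgents ⟩
    N + length coveredVertices * f
      ∎
    where
    open ≡-Reasoning
    elementAgents allDummyAgents : List (Ag n N f)
    elementAgents  = map elemA (allFin N)
    allDummyAgents = concatMap dummyAgents (allFin n)

  matchCost-μ≤ : ∀ k → length T ≤ k → matchCost I' μ ≤ N + k * f
  matchCost-μ≤ k T≤k = ≤-trans (≤-reflexive matchCost-μ)
    (+-monoʳ-≤ N (*-monoˡ-≤ f (≤-trans coveredVertices≤T T≤k)))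

mainTheorem6 : (G : Graph) → Loopless G → (k : ℕ) → 1 ≤ k →
    (ε : ℚ) → .{{_ : Positive ε}} → ε ℚ.≤ ½ →
    (uOrd : Fin (Graph.n G) → List (Fin (fNε (Graph.N G) ε))) →
    (∀ j → uOrd j ↭ allFin (fNε (Graph.N G) ε)) →
    (aOrd : Fin (Graph.n G) → List (Fin (Graph.N G))) →
    (∀ j → aOrd j ↭ incident G j) →
    (∃[ T ] (IsVertexCover G T × length T ≤ k)) →
    let I' = constructed G (fNε (Graph.N G) ε) uOrd aOrd in
    ∃[ μ ] (APerfect I' μ × EnvyFree I' μ
            × matchCost I' μ ≤ Graph.N G + k * fNε (Graph.N G) ε)
mainTheorem6 G loopless k _ ε _ uOrd uOrd-complete aOrd aOrd-incident (T , cover , T≤k) =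
  μ , μ-perfect , μ-envyFree , matchCost-μ≤ k T≤k
  where open CoverMatching G loopless (fNε (Graph.N G) ε) uOrd uOrd-complete aOrd aOrd-incident T cover
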